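{- Let $G_1$ be a cograph and $x\in V(G_1)$. (a) If $G_2$ is obtained from $G_1$ by adding a true twin $y$ of $x$, then $ccn(G_1)\le ccn(G_2)$. (b) If $G_3$ is obtained from $G_1$ by adding a false twin $z$ of $x$, then $ccn(G_1)=ccn(G_3)$.
   Context: A cograph is a graph with no induced path on $4$ vertices. Adding a true twin $y$ of $x$ means adding a new vertex $y$ with $N[y]=N[x]$; adding a false twin $z$ of $x$ means adding a new vertex $z$ with $N(z)=N(x)$. Game of Cops and Robbers: cops choose vertices first, then the robber; players alternate, each moving to an adjacent vertex or staying; capture when a cop occupies the robber's vertex. The robber is confined if it has to stay at its current vertex in order to avoid capture in the next move of the cops. $ccn(G)$, the confining cop number, is the minimum number of cops that can force confinement (or capture) of the robber. -}

module Defs where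

open import Data.Nat using (ℕ; suc; _<_)
open import Data.Fin using (Fin; inject₁; fromℕ)
open import Data.Bool using (Bool; true; false)
open import Data.Product using (Σ; ∃; _×_; _,_)
open import Data.Sum using (_⊎_)
open import Relation.Binary.PropositionalEquality using (_≡_; _≢_)
open import Relation.Nullary using (¬_)

record Graph (n : ℕ) : Set where
  field
    adj   : Fin n → Fin n → Bool
    sym   : ∀ u v → adj u v ≡ adj v u
    irrefl : ∀ v → adj v v ≡ false

open Graph public

Adj : ∀ {n} → Graph n → Fin n → Fin n → Set
Adj G u v = adj G u v ≡ true

NonAdj : ∀ {n} → Graph n → Fin n → Fin n → Set
NonAdj G u v = adj G u v ≡ false

-- Induced path a - b - c - d on four vertices (distinctness of a,b,c,d
-- is implied by the adjacency / non-adjacency conditions and irreflexivity).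
InducedP4 : ∀ {n} → Graph n → Fin n → Fin n → Fin n → Fin n → Set
InducedP4 G a b c d =
  Adj G a b × Adj G b c × Adj G c d ×
  NonAdj G a c × NonAdj G b d × NonAdj G a d

Cograph : ∀ {n} → Graph n → Set
Cograph {n} G = ∀ (a b c d : Fin n) → ¬ InducedP4 G a b c d

-- G2 (on Fin (suc n)) is obtained from G1 by adding a new vertex
-- y = fromℕ n; old vertices are embedded via inject₁.
Extends : ∀ {n} → Graph n → Graph (suc n) → Set
Extends {n} G1 G2 = ∀ (u v : Fin n) → adj G2 (inject₁ u) (inject₁ v) ≡ adj G1 u v

IsTrueTwinExtension : ∀ {n} → Graph n → Fin n → Graph (suc n) → Set
IsTrueTwinExtension {n} G1 x G2 =
  Extends G1 G2 ×
  Adj G2 (fromℕ n) (inject₁ x) ×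
  (∀ (u : Fin n) → u ≢ x → adj G2 (fromℕ n) (inject₁ u) ≡ adj G1 x u)

-- z = fromℕ n is a false twin of x in G3: N(z) = N(x)
-- (in particular z is not adjacent to x).
IsFalseTwinExtension : ∀ {n} → Graph n → Fin n → Graph (suc n) → Set
IsFalseTwinExtension {n} G1 x G3 =
  Extends G1 G3 ×
  (∀ (u : Fin n) → adj G3 (fromℕ n) (inject₁ u) ≡ adj G1 x u)

Config : ℕ → ℕ → Set
Config k n = Fin k → Fin n

InN[ : ∀ {n} → Graph n → Fin n → Fin n → Set
InN[ G v u = u ≡ v ⊎ Adj G v u

CopMove : ∀ {n k} → Graph n → Config k n → Config k n → Set
CopMove G C C' = ∀ i → InN[ G (C i) (C' i)

Captured : ∀ {n k} → Config k n → Fin n → Set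
Captured {k = k} C r = ∃ λ (i : Fin k) → C i ≡ r

Guarded : ∀ {n k} → Graph n → Config k n → Fin n → Set
Guarded {k = k} G C u = ∃ λ (i : Fin k) → InN[ G (C i) u

-- Robber (to move, at r) is confined: every neighbour of r is guarded,
-- so it has to stay at r in order to avoid capture in the next cop move.
Confined : ∀ {n k} → Graph n → Config k n → Fin n → Set
Confined G C r = ∀ u → Adj G r u → Guarded G C u

-- Cops can force capture or confinement.  Positions with the robber to
-- move (WinR) and with the cops to move (WinC); least fixed point =
-- cops force the goal in finitely many rounds.
mutual
  data WinR {n k} (G : Graph n) : Config k n → Fin n → Set where
    done : ∀ {C r} → Captured C r ⊎ Confined G C r → WinR G C r
    robberMoves : ∀ {C r} →
      (∀ r' → InN[ G r r' → ¬ Captured C r' → WinC G C r') → WinR G C r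

  data WinC {n k} (G : Graph n) : Config k n → Fin n → Set where
    copsMove : ∀ {C r} (C' : Config k n) → CopMove G C C' → WinR G C' r →
      WinC G C r

-- k cops can force confinement (or capture): cops choose positions,
-- then the robber chooses its position, then the cops move first.
CopsConfine : ∀ {n} → Graph n → ℕ → Set
CopsConfine {n} G k = Σ (Config k n) λ C → ∀ (r : Fin n) → WinC G C r

IsCcn : ∀ {n} → Graph n → ℕ → Set
IsCcn G m = CopsConfine G m × (∀ j → j < m → ¬ CopsConfine G j)

module Submission where

-- Neither direction
-- uses that G is a cograph; both hold for arbitrary graphs.
--
-- (1) Collapsing the new vertex onto x is a retraction H → G that maps
--     closed neighbourhoods into closed neighbourhoods whenever every
--     neighbour of the new vertex lies in N[x]; this holds for true and
--     for false twins.  Cops of a confining strategy in H, projected by a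
--     retraction, confine the robber in G, so ccn(G) ≤ ccn(H).  This is
--     part (a) and half of part (b).
-- (2) For a false twin z of x the converse holds as well: the cops play
--     their G-strategy against the robber's "shadow", which is the robber
--     itself on old vertices and x when the robber sits on z.  A capture
--     or confinement of the shadow becomes a capture or confinement of the
--     robber, up to one extra round when the robber is adjacent to x while
--     a cop sits on x.  Hence ccn(H) ≤ ccn(G), and with (1) part (b) follows.

open import Defs hiding (sym)
open import Data.Nat using (suc; _≤_)
open import Data.Nat.Properties using (≮⇒≥; ≤-antisym)
open import Data.Fin using (Fin; inject₁; fromℕ; _≟_)
open import Data.Fin.Properties using (fromℕ≢inject₁; inject₁-injective; any?)
open import Data.Fin.Relation.Unary.Top using (view; view-inject₁; ‵fromℕ; ‵inj₁)
open import Data.Vec.Functional using (updateAt)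
open import Data.Vec.Functional.Properties using (updateAt-updates; updateAt-minimal)
open import Data.Product using (∃; _×_; _,_)
open import Data.Sum using (inj₁; inj₂)
open import Data.Bool using (true; false)
open import Data.Empty using (⊥-elim)
open import Function using (_∘_; const)
open import Relation.Nullary using (¬_; yes; no)
open import Relation.Binary.PropositionalEquality

true≢false : true ≢ false
true≢false ()

noLoop : ∀ {n} (G : Graph n) v → ¬ Adj G v v
noLoop G v a = true≢false (trans (sym a) (irrefl G v))

adj-sym : ∀ {n} (G : Graph n) {u v} → Adj G u v → Adj G v u
adj-sym G {u} {v} a = trans (Graph.sym G v u) a

stay : ∀ {n k} (G : Graph n) (C : Config k n) → CopMove G C C
stay G C i = inj₁ refl

wait : ∀ {n k} {G : Graph n} {C : Config k n} {r} → WinR G C r → WinC G C r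
wait {G = G} {C} w = copsMove C (stay G C) w

catch : ∀ {n k} (G : Graph n) (C : Config k n) r → Guarded G C r → WinC G C r
catch G C r (i , g) = copsMove (updateAt C i (const r)) move
  (done (inj₁ (i , updateAt-updates i C)))
  where
  move : CopMove G C (updateAt C i (const r))
  move j with j ≟ i
  ... | yes refl = subst (InN[ G (C i)) (sym (updateAt-updates i C)) g
  ... | no j≢i   = inj₁ (updateAt-minimal j i C j≢i)

ccn-≤ : ∀ {n m} {G : Graph n} {H : Graph m} {a b} → IsCcn G a → IsCcn H b →
        (CopsConfine H b → CopsConfine G b) → a ≤ b
ccn-≤ {b = b} (_ , minimalG) (confineH , _) transfer =
  ≮⇒≥ (λ b<a → minimalG b b<a (transfer confineH))

module Extension {n} (G : Graph n) (H : Graph (suc n)) (ext : Extends G H) where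

  old-adj : ∀ {u v} → Adj G u v → Adj H (inject₁ u) (inject₁ v)
  old-adj {u} {v} a = trans (ext u v) a

  old-N : ∀ {u v} → InN[ G u v → InN[ H (inject₁ u) (inject₁ v)
  old-N (inj₁ refl) = inj₁ refl
  old-N (inj₂ a)    = inj₂ (old-adj a)

  old-N⁻¹ : ∀ {u v} → InN[ H (inject₁ u) (inject₁ v) → InN[ G u v
  old-N⁻¹ (inj₁ e)          = inj₁ (inject₁-injective e)
  old-N⁻¹ {u} {v} (inj₂ a) = inj₂ (trans (sym (ext u v)) a)

-- Projecting a
-- winning cop strategy of H along f wins in G against a robber that stays
-- on old vertices, so confining strategies transfer from H to G.

module Retract {n} (G : Graph n) (H : Graph (suc n)) (ext : Extends G H)
  (f : Fin (suc n) → Fin n) (f-fixes : ∀ u → f (inject₁ u) ≡ u)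
  (f-N : ∀ {u v} → InN[ H u v → InN[ G (f u) (f v)) where

  open Extension G H ext

  push-captured : ∀ {k} {C : Config k (suc n)} {r} →
                  Captured C (inject₁ r) → Captured (f ∘ C) r
  push-captured {r = r} (i , eq) = i , trans (cong f eq) (f-fixes r)

  push-guarded : ∀ {k} {C : Config k (suc n)} {u} →
                 Guarded H C (inject₁ u) → Guarded G (f ∘ C) u
  push-guarded {C = C} {u} (i , g) = i , subst (InN[ G (f (C i))) (f-fixes u) (f-N g)

  mutual
    pushR : ∀ {k} {C : Config k (suc n)} {r} → WinR H C (inject₁ r) → WinR G (f ∘ C) r
    pushR (done (inj₁ cap))   = done (inj₁ (push-captured cap))
    pushR (done (inj₂ conf))  = done (inj₂ λ u a → push-guarded (conf (inject₁ u) (old-adj a)))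
    pushR (robberMoves moves) = robberMoves λ r' nb free →
      pushC (moves (inject₁ r') (old-N nb) (free ∘ push-captured))

    pushC : ∀ {k} {C : Config k (suc n)} {r} → WinC H C (inject₁ r) → WinC G (f ∘ C) r
    pushC (copsMove C' move w) = copsMove (f ∘ C') (f-N ∘ move) (pushR w)

  transfer : ∀ {k} → CopsConfine H k → CopsConfine G k
  transfer (C , win) = f ∘ C , λ r → pushC (win (inject₁ r))

collapse : ∀ {n} → Fin n → Fin (suc n) → Fin n
collapse x v with view v
... | ‵fromℕ          = x
... | ‵inj₁ {i = u} _ = u

collapse-fixes : ∀ {n} (x : Fin n) u → collapse x (inject₁ u) ≡ u
collapse-fixes x u rewrite view-inject₁ u = refl

collapse-N : ∀ {n} (G : Graph n) (H : Graph (suc n)) → Extends G H → (x : Fin n) →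
             (∀ v → Adj H (fromℕ n) (inject₁ v) → InN[ G x v) →
             ∀ {u v} → InN[ H u v → InN[ G (collapse x u) (collapse x v)
collapse-N G H ext x within (inj₁ refl) = inj₁ refl
collapse-N G H ext x within {u} {v} (inj₂ a) with view u | view v
... | ‵fromℕ          | ‵fromℕ          = ⊥-elim (noLoop H _ a)
... | ‵fromℕ          | ‵inj₁ {i = v'} _ = within v' a
... | ‵inj₁ {i = u'} _ | ‵fromℕ          with within u' (adj-sym H a)
...   | inj₁ u'≡x = inj₁ (sym u'≡x)
...   | inj₂ x~u' = inj₂ (adj-sym G x~u')
collapse-N G H ext x within {u} {v} (inj₂ a)
    | ‵inj₁ {i = u'} _ | ‵inj₁ {i = v'} _ = inj₂ (trans (sym (ext u' v')) a)

collapse-transfer : ∀ {n} (G : Graph n) (H : Graph (suc n)) → Extends G H → (x : Fin n) →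
                    (∀ v → Adj H (fromℕ n) (inject₁ v) → InN[ G x v) →
                    ∀ {k} → CopsConfine H k → CopsConfine G k
collapse-transfer G H ext x within =
  Retract.transfer G H ext (collapse x) (collapse-fixes x) (collapse-N G H ext x within)

trueTwin-within : ∀ {n} (G : Graph n) x (H : Graph (suc n)) → IsTrueTwinExtension G x H →
                  ∀ v → Adj H (fromℕ n) (inject₁ v) → InN[ G x v
trueTwin-within G x H (_ , _ , twin) v a with v ≟ x
... | yes v≡x = inj₁ v≡x
... | no  v≢x = inj₂ (trans (sym (twin v v≢x)) a)

falseTwin-within : ∀ {n} (G : Graph n) x (H : Graph (suc n)) → IsFalseTwinExtension G x H →
                   ∀ v → Adj H (fromℕ n) (inject₁ v) → InN[ G x v
falseTwin-within G x H (_ , twin) v a = inj₂ (trans (sym (twin v)) a)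

-- False twins: lifted cops of G chase the robber's shadow in H, so
-- confining strategies transfer from G to H.
module FalseTwin {n} (G : Graph n) (H : Graph (suc n)) (x : Fin n) (ext : Extends G H)
  (twin : ∀ u → adj H (fromℕ n) (inject₁ u) ≡ adj G x u) where

  open Extension G H ext

  z : Fin (suc n)
  z = fromℕ n

  lift : ∀ {k} → Config k n → Config k (suc n)
  lift C = inject₁ ∘ C

  z-adj⁻¹ : ∀ {u} → Adj H z (inject₁ u) → Adj G x u
  z-adj⁻¹ {u} a = trans (sym (twin u)) a

  old-z-adj : ∀ u → adj H (inject₁ u) z ≡ adj G u x
  old-z-adj u = trans (Graph.sym H _ _) (trans (twin u) (Graph.sym G x u))

  lift-guarded : ∀ {k} {C : Config k n} {u} → Guarded G C u → Guarded H (lift C) (inject₁ u)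
  lift-guarded (i , g) = i , old-N g

  data Shadow : Fin (suc n) → Fin n → Set where
    same   : ∀ s → Shadow (inject₁ s) s
    onTwin : Shadow z x

  shadow-of : ∀ r → ∃ (Shadow r)
  shadow-of r with view r
  ... | ‵fromℕ          = x , onTwin
  ... | ‵inj₁ {i = u} _ = u , same u

  shadow-step : ∀ {r r' s} → Shadow r s → InN[ H r r' → ∃ λ s' → Shadow r' s' × InN[ G s s'
  shadow-step {r' = r'} (same s) nb with view r'
  ... | ‵fromℕ with nb
  ...   | inj₁ e = ⊥-elim (fromℕ≢inject₁ e)
  ...   | inj₂ a = x , onTwin , inj₂ (trans (sym (old-z-adj s)) a)
  shadow-step {r' = r'} (same s) nb | ‵inj₁ {i = u} _ = u , same u , old-N⁻¹ nb
  shadow-step {r' = r'} onTwin nb with view r'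
  ... | ‵fromℕ = x , onTwin , inj₁ refl
  ... | ‵inj₁ {i = u} _ with nb
  ...   | inj₁ e = ⊥-elim (fromℕ≢inject₁ (sym e))
  ...   | inj₂ a = u , same u , inj₂ (z-adj⁻¹ a)

  z-confined : ∀ {k} (C : Config k n) i → C i ≡ x → Confined H (lift C) z
  z-confined C i Ci≡x u a with view u
  ... | ‵fromℕ = ⊥-elim (noLoop H _ a)
  ... | ‵inj₁ {i = u'} _ = i , inj₂ (old-adj (subst (λ w → Adj G w u') (sym Ci≡x) (z-adj⁻¹ a)))

  shadow-captured : ∀ {k} {C : Config k n} {r s} → Shadow r s → Captured C s → WinR H (lift C) r
  shadow-captured (same s) (i , eq) = done (inj₁ (i , cong inject₁ eq))
  shadow-captured {C = C} onTwin (i , eq) = done (inj₂ (z-confined C i eq))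

  lift-confined : ∀ {k} {C : Config k n} {s} → Confined G C s →
                  (Adj H (inject₁ s) z → Guarded H (lift C) z) → Confined H (lift C) (inject₁ s)
  lift-confined conf z-ok u a with view u
  ... | ‵fromℕ = z-ok a
  ... | ‵inj₁ {i = u'} _ = lift-guarded (conf u' (trans (sym (ext _ u')) a))

  -- A confined shadow next to x, with a cop on x: the robber may escape to z
  -- (where it is confined), and every other move is into a guarded vertex.
  cornered : ∀ {k} {C : Config k n} {s} i → C i ≡ x → Adj G s x → Confined G C s →
             WinR H (lift C) (inject₁ s)
  cornered {C = C} {s} i Ci≡x s~x conf = robberMoves λ r' nb _ → escape r' nb
    where
    escape : ∀ r' → InN[ H (inject₁ s) r' → WinC H (lift C) r'
    escape r' nb with view r'
    ... | ‵fromℕ = wait (done (inj₂ (z-confined C i Ci≡x)))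
    ... | ‵inj₁ {i = u} _ with old-N⁻¹ nb
    ...   | inj₁ refl = catch H (lift C) _
                (i , inj₂ (old-adj (subst (λ w → Adj G w s) (sym Ci≡x) (adj-sym G s~x))))
    ...   | inj₂ s~u = catch H (lift C) _ (lift-guarded (conf u s~u))

  shadow-confined : ∀ {k} {C : Config k n} {r s} → Shadow r s → Confined G C s → WinR H (lift C) r
  shadow-confined {C = C} onTwin conf = done (inj₂ guard)
    where
    guard : Confined H (lift C) z
    guard u a with view u
    ... | ‵fromℕ = ⊥-elim (noLoop H _ a)
    ... | ‵inj₁ {i = u'} _ = lift-guarded (conf u' (z-adj⁻¹ a))
  shadow-confined (same s) conf with adj G s x in s?x
  ... | false = done (inj₂ (lift-confined conf λ a →
                  ⊥-elim (true≢false (trans (sym a) (trans (old-z-adj s) s?x)))))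
  ... | true with conf x s?x
  ...   | i , inj₂ Ci~x = done (inj₂ (lift-confined conf λ _ →
                            i , inj₂ (trans (old-z-adj _) Ci~x)))
  ...   | i , inj₁ x≡Ci = cornered i (sym x≡Ci) s?x conf

  mutual
    shadowR : ∀ {k} {C : Config k n} {r s} → Shadow r s → WinR G C s → WinR H (lift C) r
    shadowR sh (done (inj₁ cap))  = shadow-captured sh cap
    shadowR sh (done (inj₂ conf)) = shadow-confined sh conf
    shadowR {C = C} {r} sh (robberMoves moves) = robberMoves λ r' nb _ → follow r' nb
      where
      follow : ∀ r' → InN[ H r r' → WinC H (lift C) r'
      follow r' nb with shadow-step sh nb
      ... | s' , sh' , nb' with any? (λ j → C j ≟ s')
      ...   | yes cap = wait (shadow-captured sh' cap)
      ...   | no free = shadowC sh' (moves s' nb' free)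

    shadowC : ∀ {k} {C : Config k n} {r s} → Shadow r s → WinC G C s → WinC H (lift C) r
    shadowC sh (copsMove C' move w) = copsMove (lift C') (old-N ∘ move) (shadowR sh w)

  transfer : ∀ {k} → CopsConfine G k → CopsConfine H k
  transfer (C , win) = lift C , λ r → let (s , sh) = shadow-of r in shadowC sh (win s)

theorem3p3 : ∀ {n} (G1 : Graph n) → Cograph G1 → (x : Fin n) →
    (∀ (G2 : Graph (suc n)) → IsTrueTwinExtension G1 x G2 →
       ∀ a b → IsCcn G1 a → IsCcn G2 b → a ≤ b)
  × (∀ (G3 : Graph (suc n)) → IsFalseTwinExtension G1 x G3 →
       ∀ a b → IsCcn G1 a → IsCcn G3 b → a ≡ b)
theorem3p3 {n} G1 _ x = trueTwinCase , falseTwinCase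
  where
  trueTwinCase : ∀ (G2 : Graph (suc n)) → IsTrueTwinExtension G1 x G2 →
                 ∀ a b → IsCcn G1 a → IsCcn G2 b → a ≤ b
  trueTwinCase G2 tt@(ext , _) _ _ ccnG1 ccnG2 =
    ccn-≤ ccnG1 ccnG2 (collapse-transfer G1 G2 ext x (trueTwin-within G1 x G2 tt))

  falseTwinCase : ∀ (G3 : Graph (suc n)) → IsFalseTwinExtension G1 x G3 →
                  ∀ a b → IsCcn G1 a → IsCcn G3 b → a ≡ b
  falseTwinCase G3 ft@(ext , twin) _ _ ccnG1 ccnG3 = ≤-antisym
    (ccn-≤ ccnG1 ccnG3 (collapse-transfer G1 G3 ext x (falseTwin-within G1 x G3 ft)))
    (ccn-≤ ccnG3 ccnG1 (FalseTwin.transfer G1 G3 x ext twin))
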